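{- Let $(V,E)$ be a finite connected graph, $a_0,a_1\in V$ two distinct vertices, $\omega>0$, $\lambda=i\omega$, and for each edge $xy$ let $R_{xy},L_{xy},D_{xy}\ge 0$ with $R_{xy}^2+L_{xy}^2+D_{xy}^2\ne0$, impedance $z_{xy}=R_{xy}+L_{xy}i\omega+\dfrac{D_{xy}}{i\omega}\neq0$ and admittance $\rho_{xy}=1/z_{xy}$ (and $\rho_{xy}=0$ if $xy\notin E$). Define the effective impedance $Z_{eff}\in\mathbb{C}\cup\{\infty\}$ as follows: if the Dirichlet problem $$\sum_{y\in V}(v(y)-v(x))\rho_{xy}=0\ (x\in V\setminus\{a_0,a_1\}),\quad v(a_0)=0,\quad v(a_1)=1$$ has no solution $v:V\to\mathbb{C}$, then $Z_{eff}=0$; otherwise $Z_{eff}=1/\sum_{x:x\sim a_0}v(x)\rho_{xa_0}$ for a solution $v$ (this value does not depend on the choice of solution). Then, when $Z_{eff}\in\mathbb{C}$, $\Re(Z_{eff})\ge0$. Moreover, if $\Im(z_{xy})\le 0$ for every $xy\in E$, then $\Im(Z_{eff})\le0$, and if $\Im(z_{xy})\ge0$ for every $xy\in E$, then $\Im(Z_{eff})\ge0$.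
   Context: $R_{xy},L_{xy},D_{xy}$ are resistance, inductance and inverse capacitance of the edge. $x\sim a_0$ means $x$ is adjacent to $a_0$. -}

module Defs where

open import Data.Nat using (ℕ; zero; suc)
open import Data.Fin using (Fin; zero; suc)
open import Data.Bool using (Bool; true; false; if_then_else_)
open import Data.Product using (_×_; _,_; proj₁; proj₂; Σ; ∃)
open import Data.Sum using (_⊎_; inj₁; inj₂)
open import Data.Maybe using (Maybe; just; nothing)
open import Relation.Binary.PropositionalEquality using (_≡_; _≢_)
open import Relation.Nullary using (¬_)
open import Relation.Binary.Construct.Closure.ReflexiveTransitive using (Star)

-- Any model is isomorphic to ℝ, so quantifying over
-- all models is the same as speaking about ℝ.
record RealField : Set₁ where
  infixl 6 _+_
  infixl 7 _*_
  infix 4 _≤_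
  field
    Carrier : Set
    0# 1# : Carrier
    _+_ _*_ : Carrier → Carrier → Carrier
    -_ : Carrier → Carrier
    _⁻¹ : Carrier → Carrier          -- total; only meaningful on nonzero elements
    _≤_ : Carrier → Carrier → Set
    +-assoc : ∀ x y z → (x + y) + z ≡ x + (y + z)
    +-comm : ∀ x y → x + y ≡ y + x
    +-identityˡ : ∀ x → 0# + x ≡ x
    +-inverseˡ : ∀ x → (- x) + x ≡ 0#
    *-assoc : ∀ x y z → (x * y) * z ≡ x * (y * z)
    *-comm : ∀ x y → x * y ≡ y * x
    *-identityˡ : ∀ x → 1# * x ≡ x
    distribˡ : ∀ x y z → x * (y + z) ≡ x * y + x * z
    0≢1 : 0# ≢ 1#
    ⁻¹-inverseʳ : ∀ x → x ≢ 0# → x * (x ⁻¹) ≡ 1#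
    ≤-refl : ∀ x → x ≤ x
    ≤-trans : ∀ {x y z} → x ≤ y → y ≤ z → x ≤ z
    ≤-antisym : ∀ {x y} → x ≤ y → y ≤ x → x ≡ y
    ≤-total : ∀ x y → (x ≤ y) ⊎ (y ≤ x)
    +-monoˡ-≤ : ∀ {x y} z → x ≤ y → x + z ≤ y + z
    *-nonneg : ∀ {x y} → 0# ≤ x → 0# ≤ y → 0# ≤ x * y
    sup : (P : Carrier → Set) → (∃ P) → (∃ λ b → ∀ x → P x → x ≤ b) →
          ∃ λ s → (∀ x → P x → x ≤ s) × (∀ b → (∀ x → P x → x ≤ b) → s ≤ b)

  _<_ : Carrier → Carrier → Set
  x < y = (x ≤ y) × (x ≢ y)
  infix 4 _<_

module Complex (F : RealField) where
  open RealField F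

  ℂ : Set
  ℂ = Carrier × Carrier

  re im : ℂ → Carrier
  re = proj₁
  im = proj₂

  0ᶜ 1ᶜ : ℂ
  0ᶜ = 0# , 0#
  1ᶜ = 1# , 0#

  ofReal : Carrier → ℂ
  ofReal r = r , 0#

  iᶜ* : Carrier → ℂ
  iᶜ* r = 0# , r

  infixl 6 _+ᶜ_ _-ᶜ_
  infixl 7 _*ᶜ_
  _+ᶜ_ : ℂ → ℂ → ℂ
  (a , b) +ᶜ (c , d) = a + c , b + d

  -ᶜ_ : ℂ → ℂ
  -ᶜ (a , b) = - a , - b

  _-ᶜ_ : ℂ → ℂ → ℂ
  u -ᶜ w = u +ᶜ (-ᶜ w)

  _*ᶜ_ : ℂ → ℂ → ℂ
  (a , b) *ᶜ (c , d) = a * c + - (b * d) , a * d + b * c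

  -- 1/(a+bi) = (a - bi)/(a²+b²)   (meaningful for nonzero arguments)
  invᶜ : ℂ → ℂ
  invᶜ (a , b) = a * (a * a + b * b) ⁻¹ , - b * (a * a + b * b) ⁻¹

  sumᶜ : ∀ {n} → (Fin n → ℂ) → ℂ
  sumᶜ {zero} f = 0ᶜ
  sumᶜ {suc n} f = f zero +ᶜ sumᶜ (λ i → f (suc i))

module Network (F : RealField) where
  open RealField F
  open Complex F

  Edge : ∀ {n} → (Fin n → Fin n → Bool) → Fin n → Fin n → Set
  Edge adj x y = adj x y ≡ true

  Connected : ∀ {n} → (Fin n → Fin n → Bool) → Set
  Connected {n} adj = ∀ (x y : Fin n) → Star (Edge adj) x y

  impedance : (ω R L D : Carrier) → ℂ
  impedance ω R L D = ofReal R +ᶜ ofReal L *ᶜ iᶜ* ω +ᶜ ofReal D *ᶜ invᶜ (iᶜ* ω)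

  admittance : ∀ {n} → (Fin n → Fin n → Bool) → (Fin n → Fin n → ℂ) → Fin n → Fin n → ℂ
  admittance adj z x y = if adj x y then invᶜ (z x y) else 0ᶜ

  Dirichlet : ∀ {n} → (Fin n → Fin n → ℂ) → (a₀ a₁ : Fin n) → (Fin n → ℂ) → Set
  Dirichlet ρ a₀ a₁ v =
    (∀ x → x ≢ a₀ → x ≢ a₁ → sumᶜ (λ y → (v y -ᶜ v x) *ᶜ ρ x y) ≡ 0ᶜ)
    × v a₀ ≡ 0ᶜ × v a₁ ≡ 1ᶜ

  current : ∀ {n} → (Fin n → Fin n → Bool) → (Fin n → Fin n → ℂ) → Fin n → (Fin n → ℂ) → ℂ
  current adj ρ a₀ v = sumᶜ (λ x → if adj x a₀ then v x *ᶜ ρ x a₀ else 0ᶜ)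

  -- EffImp adj ρ a₀ a₁ Z : Z is the effective impedance (nothing = ∞)
  data EffImp {n} (adj : Fin n → Fin n → Bool) (ρ : Fin n → Fin n → ℂ) (a₀ a₁ : Fin n) : Maybe ℂ → Set where
    noSolution : ¬ (∃ λ v → Dirichlet ρ a₀ a₁ v) → EffImp adj ρ a₀ a₁ (just 0ᶜ)
    infinite : ∀ v → Dirichlet ρ a₀ a₁ v → current adj ρ a₀ v ≡ 0ᶜ → EffImp adj ρ a₀ a₁ nothing
    finite : ∀ v → Dirichlet ρ a₀ a₁ v → current adj ρ a₀ v ≢ 0ᶜ →
             EffImp adj ρ a₀ a₁ (just (invᶜ (current adj ρ a₀ v)))

module Submission where

open import Defs
open import Data.Nat using (ℕ; zero; suc)
open import Data.Fin using (Fin; zero; suc)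
open import Data.Fin.Properties using (_≟_)
open import Data.Bool using (Bool; true; false; if_then_else_)
open import Data.Product using (_×_; _,_; proj₁; proj₂)
open import Data.Sum using (inj₁; inj₂)
open import Data.Maybe using (Maybe; just; nothing)
open import Relation.Binary.PropositionalEquality using (_≡_; _≢_)
open import Relation.Nullary using (¬_; yes; no)
open import Algebra.Bundles using (CommutativeRing)

-- Let v solve the Dirichlet problem and let
-- I = Σ_{x∼a₀} v(x) ρ_{xa₀} be the current, so that Z = 1/I.  Since
-- v(a₀) = 0, I is the value (Δv)(a₀) of the network Laplacian
-- (Δv)(x) = Σ_y (v y − v x) ρ_xy.  Summation by parts (a discrete Green
-- identity, valid because ρ is symmetric) with the test function u = 1 − v,
-- which vanishes at a₁ and equals 1 at a₀, gives the energy identity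
--     2 I = Σ_{x,y} |v y − v x|² ρ_xy.
-- Hence any sign condition on re ρ or im ρ that is stable under sums and
-- nonnegative multiples (a "cone") passes to I, and then to Z = conj I/|I|²
-- (the imaginary part flipping sign); the same inversion argument turns the
-- hypotheses on z = R + Liω + D/(iω) into sign conditions on ρ = 1/z.

-- A ring solver with integer coefficients for an arbitrary commutative
-- ring: integers act on any ring through the canonical homomorphism
-- ℤ → R, and integer equality is decidable.
module IntegerCoefficientSolver {c ℓ} (R : CommutativeRing c ℓ) where
  import Data.Nat as ℕ
  import Data.Nat.Properties as ℕ
  open import Data.Integer as ℤ using (ℤ; +_; -[1+_])
  import Data.Integer.Properties as ℤ
  open import Relation.Binary.PropositionalEquality using (cong)
  open CommutativeRing R
  open import Algebra.Properties.Ring ring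
    using (-0#≈0#; -‿involutive; -‿+-comm; -‿distribˡ-*; -‿distribʳ-*)
  open import Algebra.Properties.Semiring.Mult semiring using (×-homo-+; ×1-homo-*)
    renaming (_×_ to _·_)
  open import Algebra.Solver.Ring.AlmostCommutativeRing
    using (fromCommutativeRing; _-Raw-AlmostCommutative⟶_)
  open import Relation.Binary.Reasoning.Setoid setoid

  ⟦_⟧ℤ : ℤ → Carrier
  ⟦ + n ⟧ℤ = n · 1#
  ⟦ -[1+ n ] ⟧ℤ = - (suc n · 1#)

  private
    x-0≈x : ∀ x → x - 0# ≈ x
    x-0≈x x = trans (+-congˡ -0#≈0#) (+-identityʳ x)

    [1+x]-[1+y]≈x-y : ∀ x y → (1# + x) - (1# + y) ≈ x - y
    [1+x]-[1+y]≈x-y x y = begin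
      (1# + x) - (1# + y)     ≈⟨ +-congˡ (sym (-‿+-comm 1# y)) ⟩
      (1# + x) + (- 1# - y)   ≈⟨ +-assoc 1# x _ ⟩
      1# + (x + (- 1# - y))   ≈⟨ +-congˡ (sym (+-assoc x (- 1#) (- y))) ⟩
      1# + ((x - 1#) - y)     ≈⟨ +-congˡ (+-congʳ (+-comm x (- 1#))) ⟩
      1# + ((- 1# + x) - y)   ≈⟨ +-congˡ (+-assoc (- 1#) x (- y)) ⟩
      1# + (- 1# + (x - y))   ≈⟨ sym (+-assoc 1# (- 1#) _) ⟩
      (1# - 1#) + (x - y)     ≈⟨ +-congʳ (-‿inverseʳ 1#) ⟩
      0# + (x - y)            ≈⟨ +-identityˡ _ ⟩
      x - y                   ∎

  ⊖-homo : ∀ m n → ⟦ m ℤ.⊖ n ⟧ℤ ≈ m · 1# - n · 1#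
  ⊖-homo m zero = begin
    ⟦ m ℤ.⊖ 0 ⟧ℤ    ≡⟨ cong ⟦_⟧ℤ (ℤ.⊖-≥ {m} {0} ℕ.z≤n) ⟩
    m · 1#          ≈⟨ sym (x-0≈x _) ⟩
    m · 1# - 0#     ∎
  ⊖-homo zero (suc n) = begin
    ⟦ 0 ℤ.⊖ suc n ⟧ℤ    ≡⟨ cong ⟦_⟧ℤ (ℤ.⊖-≤ {0} {suc n} ℕ.z≤n) ⟩
    - (suc n · 1#)      ≈⟨ sym (+-identityˡ _) ⟩
    0# - suc n · 1#     ∎
  ⊖-homo (suc m) (suc n) = begin
    ⟦ suc m ℤ.⊖ suc n ⟧ℤ            ≡⟨ cong ⟦_⟧ℤ (ℤ.[1+m]⊖[1+n]≡m⊖n m n) ⟩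
    ⟦ m ℤ.⊖ n ⟧ℤ                    ≈⟨ ⊖-homo m n ⟩
    m · 1# - n · 1#                 ≈⟨ sym ([1+x]-[1+y]≈x-y _ _) ⟩
    suc m · 1# - suc n · 1#         ∎

  +-homo : ∀ i j → ⟦ i ℤ.+ j ⟧ℤ ≈ ⟦ i ⟧ℤ + ⟦ j ⟧ℤ
  +-homo (+ m) (+ n) = ×-homo-+ 1# m n
  +-homo (+ m) -[1+ n ] = ⊖-homo m (suc n)
  +-homo -[1+ m ] (+ n) = trans (⊖-homo n (suc m)) (+-comm _ _)
  +-homo -[1+ m ] -[1+ n ] = begin
    - (suc (suc (m ℕ.+ n)) · 1#)        ≡⟨ cong (λ k → - (k · 1#)) (ℕ.+-suc (suc m) n) ⟨
    - ((suc m ℕ.+ suc n) · 1#)          ≈⟨ -‿cong (×-homo-+ 1# (suc m) (suc n)) ⟩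
    - (suc m · 1# + suc n · 1#)         ≈⟨ sym (-‿+-comm _ _) ⟩
    - (suc m · 1#) + - (suc n · 1#)     ∎

  neg-homo : ∀ i → ⟦ ℤ.- i ⟧ℤ ≈ - ⟦ i ⟧ℤ
  neg-homo (+ zero) = sym -0#≈0#
  neg-homo (+ suc n) = refl
  neg-homo -[1+ n ] = sym (-‿involutive _)

  *-homo-+ : ∀ m j → ⟦ + m ℤ.* j ⟧ℤ ≈ m · 1# * ⟦ j ⟧ℤ
  *-homo-+ m (+ n) = begin
    ⟦ + m ℤ.* + n ⟧ℤ      ≡⟨ cong ⟦_⟧ℤ (ℤ.pos-* m n) ⟨
    (m ℕ.* n) · 1#        ≈⟨ ×1-homo-* m n ⟩
    m · 1# * n · 1#       ∎
  *-homo-+ m -[1+ n ] = begin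
    ⟦ + m ℤ.* -[1+ n ] ⟧ℤ             ≡⟨ cong ⟦_⟧ℤ (ℤ.neg-distribʳ-* (+ m) (+ suc n)) ⟨
    ⟦ ℤ.- (+ m ℤ.* + suc n) ⟧ℤ        ≈⟨ neg-homo (+ m ℤ.* + suc n) ⟩
    - ⟦ + m ℤ.* + suc n ⟧ℤ            ≈⟨ -‿cong (*-homo-+ m (+ suc n)) ⟩
    - (m · 1# * suc n · 1#)           ≈⟨ -‿distribʳ-* _ _ ⟩
    m · 1# * - (suc n · 1#)           ∎

  *-homo : ∀ i j → ⟦ i ℤ.* j ⟧ℤ ≈ ⟦ i ⟧ℤ * ⟦ j ⟧ℤ
  *-homo (+ m) j = *-homo-+ m j
  *-homo -[1+ m ] j = begin
    ⟦ -[1+ m ] ℤ.* j ⟧ℤ               ≡⟨ cong ⟦_⟧ℤ (ℤ.neg-distribˡ-* (+ suc m) j) ⟨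
    ⟦ ℤ.- (+ suc m ℤ.* j) ⟧ℤ          ≈⟨ neg-homo (+ suc m ℤ.* j) ⟩
    - ⟦ + suc m ℤ.* j ⟧ℤ              ≈⟨ -‿cong (*-homo-+ (suc m) j) ⟩
    - (suc m · 1# * ⟦ j ⟧ℤ)           ≈⟨ -‿distribˡ-* _ _ ⟩
    - (suc m · 1#) * ⟦ j ⟧ℤ           ∎

  ⟦⟧ℤ-homomorphism : ℤ.+-*-rawRing -Raw-AlmostCommutative⟶ fromCommutativeRing R
  ⟦⟧ℤ-homomorphism = record
    { ⟦_⟧ = ⟦_⟧ℤ ; +-homo = +-homo ; *-homo = *-homo ; -‿homo = neg-homo
    ; 0-homo = refl ; 1-homo = +-identityʳ 1# }

  ⟦⟧ℤ-equal? : ∀ i j → Maybe (⟦ i ⟧ℤ ≈ ⟦ j ⟧ℤ)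
  ⟦⟧ℤ-equal? i j with i ℤ.≟ j
  ... | yes i≡j = just (reflexive (cong ⟦_⟧ℤ i≡j))
  ... | no _ = nothing

  open import Algebra.Solver.Ring ℤ.+-*-rawRing (fromCommutativeRing R) ⟦⟧ℤ-homomorphism ⟦⟧ℤ-equal?
    public

-- Imported after the solver module, whose ring bundle exports its own
-- refl, sym and trans.
open import Relation.Binary.PropositionalEquality
  using (refl; sym; trans; cong; cong₂; subst; isEquivalence; module ≡-Reasoning)

module OrderedField (F : RealField) where
  open RealField F
  open import Relation.Binary.Structures using (IsPreorder)
  open import Data.Integer using (+_)

  commutativeRing : CommutativeRing _ _
  commutativeRing = record
    { isCommutativeRing = record
      { isRing = record
        { +-isAbelianGroup = record
          { isGroup = record
            { isMonoid = record
              { isSemigroup = record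
                { isMagma = record { isEquivalence = isEquivalence ; ∙-cong = cong₂ _+_ }
                ; assoc = +-assoc }
              ; identity = +-identityˡ , λ x → trans (+-comm x 0#) (+-identityˡ x) }
            ; inverse = +-inverseˡ , λ x → trans (+-comm x (- x)) (+-inverseˡ x)
            ; ⁻¹-cong = cong -_ }
          ; comm = +-comm }
        ; *-cong = cong₂ _*_
        ; *-assoc = *-assoc
        ; *-identity = *-identityˡ , λ x → trans (*-comm x 1#) (*-identityˡ x)
        ; distrib = distribˡ , λ x y z → trans (*-comm (y + z) x)
                      (trans (distribˡ x y z) (cong₂ _+_ (*-comm x y) (*-comm x z))) }
      ; *-comm = *-comm }
    }

  open CommutativeRing commutativeRing public
    using (+-identityʳ; *-identityʳ; zeroˡ) renaming (-‿inverseʳ to +-inverseʳ)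
  open IntegerCoefficientSolver commutativeRing public
    using (solve; Polynomial; con; _:+_; _:*_; :-_; _:=_)

  -- The polynomial constant 0; it evaluates to 0# on the nose, so it can
  -- stand for 0# in goals handed to the solver.
  :0 : ∀ {k} → Polynomial k
  :0 = con (+ 0)

  ≤-reflexive : ∀ {x y} → x ≡ y → x ≤ y
  ≤-reflexive {x} refl = ≤-refl x

  ≤-isPreorder : IsPreorder _≡_ _≤_
  ≤-isPreorder = record
    { isEquivalence = isEquivalence ; reflexive = ≤-reflexive ; trans = ≤-trans }

  module ≤-Reasoning where
    open import Relation.Binary.Reasoning.Base.Double ≤-isPreorder public
    open import Relation.Binary.Reasoning.Syntax using (module ≤-syntax)
    open ≤-syntax _IsRelatedTo_ _IsRelatedTo_ ≲-go public

  x≤0⇒0≤-x : ∀ {x} → x ≤ 0# → 0# ≤ - x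
  x≤0⇒0≤-x {x} x≤0 = begin
    0#         ≡⟨ +-inverseʳ x ⟨
    x + - x    ≤⟨ +-monoˡ-≤ (- x) x≤0 ⟩
    0# + - x   ≡⟨ +-identityˡ (- x) ⟩
    - x        ∎
    where open ≤-Reasoning

  0≤x⇒-x≤0 : ∀ {x} → 0# ≤ x → - x ≤ 0#
  0≤x⇒-x≤0 {x} 0≤x = begin
    - x        ≡⟨ +-identityˡ (- x) ⟨
    0# + - x   ≤⟨ +-monoˡ-≤ (- x) 0≤x ⟩
    x + - x    ≡⟨ +-inverseʳ x ⟩
    0#         ∎
    where open ≤-Reasoning

  +-mono-≤ : ∀ {a b c d} → a ≤ b → c ≤ d → a + c ≤ b + d
  +-mono-≤ {a} {b} {c} {d} a≤b c≤d = begin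
    a + c   ≤⟨ +-monoˡ-≤ c a≤b ⟩
    b + c   ≡⟨ +-comm b c ⟩
    c + b   ≤⟨ +-monoˡ-≤ b c≤d ⟩
    d + b   ≡⟨ +-comm d b ⟩
    b + d   ∎
    where open ≤-Reasoning

  halve-nonneg : ∀ {a} → 0# ≤ a + a → 0# ≤ a
  halve-nonneg {a} 0≤2a with ≤-total 0# a
  ... | inj₁ 0≤a = 0≤a
  ... | inj₂ a≤0 = begin
    0#       ≤⟨ 0≤2a ⟩
    a + a    ≤⟨ +-monoˡ-≤ a a≤0 ⟩
    0# + a   ≡⟨ +-identityˡ a ⟩
    a        ∎
    where open ≤-Reasoning

  halve-nonpos : ∀ {a} → a + a ≤ 0# → a ≤ 0#
  halve-nonpos {a} 2a≤0 with ≤-total a 0#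
  ... | inj₁ a≤0 = a≤0
  ... | inj₂ 0≤a = begin
    a        ≡⟨ +-identityˡ a ⟨
    0# + a   ≤⟨ +-monoˡ-≤ a 0≤a ⟩
    a + a    ≤⟨ 2a≤0 ⟩
    0#       ∎
    where open ≤-Reasoning

  *-nonpos-nonneg : ∀ {x y} → x ≤ 0# → 0# ≤ y → x * y ≤ 0#
  *-nonpos-nonneg {x} {y} x≤0 0≤y =
    subst (_≤ 0#) (solve 2 (λ x y → :- ((:- x) :* y) := x :* y) refl x y)
      (0≤x⇒-x≤0 (*-nonneg (x≤0⇒0≤-x x≤0) 0≤y))

  square-nonneg : ∀ x → 0# ≤ x * x
  square-nonneg x with ≤-total 0# x
  ... | inj₁ 0≤x = *-nonneg 0≤x 0≤x
  ... | inj₂ x≤0 = subst (0# ≤_) (solve 1 (λ x → (:- x) :* (:- x) := x :* x) refl x)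
                     (*-nonneg (x≤0⇒0≤-x x≤0) (x≤0⇒0≤-x x≤0))

  -- A field has no nilpotents (stated constructively: x cannot be apart from 0).
  square≡0 : ∀ x → x * x ≡ 0# → ¬ (x ≢ 0#)
  square≡0 x x²≡0 x≢0 = x≢0 (begin
    x                ≡⟨ *-identityʳ x ⟨
    x * 1#           ≡⟨ cong (x *_) (⁻¹-inverseʳ x x≢0) ⟨
    x * (x * x ⁻¹)   ≡⟨ *-assoc x x (x ⁻¹) ⟨
    (x * x) * x ⁻¹   ≡⟨ cong (_* x ⁻¹) x²≡0 ⟩
    0# * x ⁻¹        ≡⟨ zeroˡ (x ⁻¹) ⟩
    0#               ∎)
    where open ≡-Reasoning

  nonneg-sum≡0 : ∀ {x y} → 0# ≤ x → 0# ≤ y → x + y ≡ 0# → x ≡ 0#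
  nonneg-sum≡0 {x} {y} 0≤x 0≤y x+y≡0 = ≤-antisym x≤0 0≤x
    where
    open ≤-Reasoning
    x≤0 : x ≤ 0#
    x≤0 = begin
      x        ≡⟨ +-identityʳ x ⟨
      x + 0#   ≤⟨ +-mono-≤ (≤-refl x) 0≤y ⟩
      x + y    ≡⟨ x+y≡0 ⟩
      0#       ∎

  -- The inverse of a positive real is positive: s⁻¹ = s · (s⁻¹)².
  ⁻¹-nonneg : ∀ {s} → 0# ≤ s → s ≢ 0# → 0# ≤ s ⁻¹
  ⁻¹-nonneg {s} 0≤s s≢0 = subst (0# ≤_) s·s⁻²≡s⁻¹ (*-nonneg 0≤s (square-nonneg (s ⁻¹)))
    where
    open ≡-Reasoning
    s·s⁻²≡s⁻¹ : s * (s ⁻¹ * s ⁻¹) ≡ s ⁻¹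
    s·s⁻²≡s⁻¹ = begin
      s * (s ⁻¹ * s ⁻¹)   ≡⟨ *-assoc s (s ⁻¹) (s ⁻¹) ⟨
      (s * s ⁻¹) * s ⁻¹   ≡⟨ cong (_* s ⁻¹) (⁻¹-inverseʳ s s≢0) ⟩
      1# * s ⁻¹           ≡⟨ *-identityˡ (s ⁻¹) ⟩
      s ⁻¹                ∎

  -- Sign conditions on
  -- currents are propagated through sums by means of cones.
  record Cone (P : Carrier → Set) : Set where
    field
      has-0 : P 0#
      +-closed : ∀ {a b} → P a → P b → P (a + b)
      scale-closed : ∀ {r a} → 0# ≤ r → P a → P (r * a)
      halve : ∀ {a} → P (a + a) → P a

  nonneg-cone : Cone (0# ≤_)
  nonneg-cone = record
    { has-0 = ≤-refl 0#
    ; +-closed = λ {a} {b} 0≤a 0≤b → ≤-trans (≤-reflexive (sym (+-identityˡ 0#))) (+-mono-≤ 0≤a 0≤b)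
    ; scale-closed = *-nonneg
    ; halve = halve-nonneg }

  nonpos-cone : Cone (_≤ 0#)
  nonpos-cone = record
    { has-0 = ≤-refl 0#
    ; +-closed = λ a≤0 b≤0 → ≤-trans (+-mono-≤ a≤0 b≤0) (≤-reflexive (+-identityˡ 0#))
    ; scale-closed = λ {r} {a} 0≤r a≤0 → subst (_≤ 0#) (*-comm a r) (*-nonpos-nonneg a≤0 0≤r)
    ; halve = halve-nonpos }

module ComplexFacts (F : RealField) where
  open RealField F
  open Complex F
  open OrderedField F

  conj : ℂ → ℂ
  conj (a , b) = a , - b

  normSq : ℂ → Carrier
  normSq (a , b) = a * a + b * b

  normSq-nonneg : ∀ w → 0# ≤ normSq w
  normSq-nonneg (a , b) = Cone.+-closed nonneg-cone (square-nonneg a) (square-nonneg b)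

  normSq-nonzero : ∀ w → w ≢ 0ᶜ → normSq w ≢ 0#
  normSq-nonzero (a , b) w≢0 |w|²≡0 =
    square≡0 a a²≡0 (λ a≡0 → square≡0 b b²≡0 (λ b≡0 → w≢0 (cong₂ _,_ a≡0 b≡0)))
    where
    a²≡0 : a * a ≡ 0#
    a²≡0 = nonneg-sum≡0 (square-nonneg a) (square-nonneg b) |w|²≡0
    b²≡0 : b * b ≡ 0#
    b²≡0 = nonneg-sum≡0 (square-nonneg b) (square-nonneg a)
             (trans (+-comm (b * b) (a * a)) |w|²≡0)

  -- invᶜ w = conj w / |w|²: the real part of 1/w has the sign of re w and
  -- its imaginary part the opposite sign of im w.
  |w|⁻²-nonneg : ∀ w → w ≢ 0ᶜ → 0# ≤ normSq w ⁻¹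
  |w|⁻²-nonneg w w≢0 = ⁻¹-nonneg (normSq-nonneg w) (normSq-nonzero w w≢0)

  re-invᶜ-nonneg : ∀ w → w ≢ 0ᶜ → 0# ≤ re w → 0# ≤ re (invᶜ w)
  re-invᶜ-nonneg w w≢0 0≤re = *-nonneg 0≤re (|w|⁻²-nonneg w w≢0)

  im-invᶜ-nonneg : ∀ w → w ≢ 0ᶜ → im w ≤ 0# → 0# ≤ im (invᶜ w)
  im-invᶜ-nonneg w w≢0 im≤0 = *-nonneg (x≤0⇒0≤-x im≤0) (|w|⁻²-nonneg w w≢0)

  im-invᶜ-nonpos : ∀ w → w ≢ 0ᶜ → 0# ≤ im w → im (invᶜ w) ≤ 0#
  im-invᶜ-nonpos w w≢0 0≤im = *-nonpos-nonneg (0≤x⇒-x≤0 0≤im) (|w|⁻²-nonneg w w≢0)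

  -- Complex polynomials: pairs of real polynomials with the operations of
  -- ℂ mirrored, so that a complex identity is two calls of the solver.
  ℂPoly : ℕ → Set
  ℂPoly k = Polynomial k × Polynomial k

  infixl 6 _+ₚ_ _-ₚ_
  infixl 7 _*ₚ_
  _+ₚ_ _-ₚ_ _*ₚ_ : ∀ {k} → ℂPoly k → ℂPoly k → ℂPoly k
  (a , b) +ₚ (c , d) = a :+ c , b :+ d
  (a , b) -ₚ (c , d) = a :+ :- c , b :+ :- d
  (a , b) *ₚ (c , d) = a :* c :+ :- (b :* d) , a :* d :+ b :* c

  conjₚ : ∀ {k} → ℂPoly k → ℂPoly k
  conjₚ (a , b) = a , :- b

  normSqₚ : ∀ {k} → ℂPoly k → Polynomial k
  normSqₚ (a , b) = a :* a :+ b :* b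

  +ᶜ-identityˡ : ∀ u → 0ᶜ +ᶜ u ≡ u
  +ᶜ-identityˡ (a , b) = cong₂ _,_ (+-identityˡ a) (+-identityˡ b)

  +ᶜ-identityʳ : ∀ u → u +ᶜ 0ᶜ ≡ u
  +ᶜ-identityʳ (a , b) = cong₂ _,_ (+-identityʳ a) (+-identityʳ b)

  +ᶜ-interchange : ∀ u w s t → (u +ᶜ w) +ᶜ (s +ᶜ t) ≡ (u +ᶜ s) +ᶜ (w +ᶜ t)
  +ᶜ-interchange (a₁ , a₂) (b₁ , b₂) (c₁ , c₂) (d₁ , d₂) =
    cong₂ _,_ (interchange a₁ b₁ c₁ d₁) (interchange a₂ b₂ c₂ d₂)
    where
    interchange : ∀ a b c d → (a + b) + (c + d) ≡ (a + c) + (b + d)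
    interchange = solve 4 (λ a b c d → (a :+ b) :+ (c :+ d) := (a :+ c) :+ (b :+ d)) refl

  -ᶜ-zeroʳ : ∀ u → u -ᶜ 0ᶜ ≡ u
  -ᶜ-zeroʳ (a , b) = cong₂ _,_ (minus-0 a) (minus-0 b)
    where
    minus-0 : ∀ a → a + - 0# ≡ a
    minus-0 = solve 1 (λ a → a :+ :- :0 := a) refl

  *ᶜ-zeroʳ : ∀ u → u *ᶜ 0ᶜ ≡ 0ᶜ
  *ᶜ-zeroʳ (a , b) = cong₂ _,_
    (solve 2 (λ a b → a :* :0 :+ :- (b :* :0) := :0) refl a b)
    (solve 2 (λ a b → a :* :0 :+ b :* :0 := :0) refl a b)

  *ᶜ-distribˡ : ∀ c u w → c *ᶜ (u +ᶜ w) ≡ c *ᶜ u +ᶜ c *ᶜ w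
  *ᶜ-distribˡ (c₁ , c₂) (u₁ , u₂) (w₁ , w₂) = cong₂ _,_
    (solve 6 (λ c₁ c₂ u₁ u₂ w₁ w₂ → proj₁ (lhs (c₁ , c₂) (u₁ , u₂) (w₁ , w₂))
                                   := proj₁ (rhs (c₁ , c₂) (u₁ , u₂) (w₁ , w₂))) refl c₁ c₂ u₁ u₂ w₁ w₂)
    (solve 6 (λ c₁ c₂ u₁ u₂ w₁ w₂ → proj₂ (lhs (c₁ , c₂) (u₁ , u₂) (w₁ , w₂))
                                   := proj₂ (rhs (c₁ , c₂) (u₁ , u₂) (w₁ , w₂))) refl c₁ c₂ u₁ u₂ w₁ w₂)
    where
    lhs rhs : ℂPoly 6 → ℂPoly 6 → ℂPoly 6 → ℂPoly 6
    lhs c u w = c *ₚ (u +ₚ w)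
    rhs c u w = c *ₚ u +ₚ c *ₚ w

  re-ofReal-*ᶜ : ∀ r w → re (ofReal r *ᶜ w) ≡ r * re w
  re-ofReal-*ᶜ r (a , b) = solve 3 (λ r a b → r :* a :+ :- (:0 :* b) := r :* a) refl r a b

  im-ofReal-*ᶜ : ∀ r w → im (ofReal r *ᶜ w) ≡ r * im w
  im-ofReal-*ᶜ r (a , b) = solve 3 (λ r a b → r :* b :+ :0 :* a := r :* b) refl r a b

  re-impedance : ∀ ω R L D → re (Network.impedance F ω R L D) ≡ R
  re-impedance ω R L D =
    solve 5 (λ ω R L D t → R :+ (L :* :0 :+ :- (:0 :* ω)) :+ (D :* (:0 :* t) :+ :- (:0 :* ((:- ω) :* t)))
                         := R) refl ω R L D ((0# * 0# + ω * ω) ⁻¹)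

  -- Pairing the terms of x and y in Σₓ conj(u x)·Σ_y (v y - v x) ρ_xy
  -- (summation by parts on a single edge, ρ_xy = ρ_yx = r).
  edge-pair : ∀ p q p′ q′ r →
    conj p *ᶜ ((q′ -ᶜ p′) *ᶜ r) +ᶜ conj q *ᶜ ((p′ -ᶜ q′) *ᶜ r) ≡ conj (p -ᶜ q) *ᶜ ((q′ -ᶜ p′) *ᶜ r)
  edge-pair (p₁ , p₂) (q₁ , q₂) (p₁′ , p₂′) (q₁′ , q₂′) (r₁ , r₂) = cong₂ _,_
    (solve 10 (λ p₁ p₂ q₁ q₂ p₁′ p₂′ q₁′ q₂′ r₁ r₂ →
        proj₁ (lhs (p₁ , p₂) (q₁ , q₂) (p₁′ , p₂′) (q₁′ , q₂′) (r₁ , r₂))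
     := proj₁ (rhs (p₁ , p₂) (q₁ , q₂) (p₁′ , p₂′) (q₁′ , q₂′) (r₁ , r₂)))
     refl p₁ p₂ q₁ q₂ p₁′ p₂′ q₁′ q₂′ r₁ r₂)
    (solve 10 (λ p₁ p₂ q₁ q₂ p₁′ p₂′ q₁′ q₂′ r₁ r₂ →
        proj₂ (lhs (p₁ , p₂) (q₁ , q₂) (p₁′ , p₂′) (q₁′ , q₂′) (r₁ , r₂))
     := proj₂ (rhs (p₁ , p₂) (q₁ , q₂) (p₁′ , p₂′) (q₁′ , q₂′) (r₁ , r₂)))
     refl p₁ p₂ q₁ q₂ p₁′ p₂′ q₁′ q₂′ r₁ r₂)
    where
    lhs rhs : ℂPoly 10 → ℂPoly 10 → ℂPoly 10 → ℂPoly 10 → ℂPoly 10 → ℂPoly 10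
    lhs p q p′ q′ r = conjₚ p *ₚ ((q′ -ₚ p′) *ₚ r) +ₚ conjₚ q *ₚ ((p′ -ₚ q′) *ₚ r)
    rhs p q p′ q′ r = conjₚ (p -ₚ q) *ₚ ((q′ -ₚ p′) *ₚ r)

  -- With the test function u = 1 - v the paired edge term is |v y - v x|² ρ_xy.
  edge-energy : ∀ p q r →
    conj ((1ᶜ -ᶜ p) -ᶜ (1ᶜ -ᶜ q)) *ᶜ ((q -ᶜ p) *ᶜ r) ≡ ofReal (normSq (q -ᶜ p)) *ᶜ r
  edge-energy (p₁ , p₂) (q₁ , q₂) (r₁ , r₂) = cong₂ _,_
    (solve 7 (λ one p₁ p₂ q₁ q₂ r₁ r₂ →
        proj₁ (lhs one (p₁ , p₂) (q₁ , q₂) (r₁ , r₂)) := proj₁ (rhs (p₁ , p₂) (q₁ , q₂) (r₁ , r₂)))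
      refl 1# p₁ p₂ q₁ q₂ r₁ r₂)
    (solve 7 (λ one p₁ p₂ q₁ q₂ r₁ r₂ →
        proj₂ (lhs one (p₁ , p₂) (q₁ , q₂) (r₁ , r₂)) := proj₂ (rhs (p₁ , p₂) (q₁ , q₂) (r₁ , r₂)))
      refl 1# p₁ p₂ q₁ q₂ r₁ r₂)
    where
    lhs : Polynomial 7 → ℂPoly 7 → ℂPoly 7 → ℂPoly 7 → ℂPoly 7
    lhs one p q r = conjₚ (((one , :0) -ₚ p) -ₚ ((one , :0) -ₚ q)) *ₚ ((q -ₚ p) *ₚ r)
    rhs : ℂPoly 7 → ℂPoly 7 → ℂPoly 7 → ℂPoly 7
    rhs p q r = (normSqₚ (q -ₚ p) , :0) *ₚ r

  -- The test function u = 1 - v is 1 where v = 0 and 0 where v = 1.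
  conj[1-0]-*ᶜ : ∀ w → conj (1ᶜ -ᶜ 0ᶜ) *ᶜ w ≡ w
  conj[1-0]-*ᶜ (a , b) = cong₂ _,_
    (trans (solve 3 (λ one a b → (one :+ :- :0) :* a :+ :- (:- (:0 :+ :- :0) :* b) := one :* a)
              refl 1# a b) (*-identityˡ a))
    (trans (solve 3 (λ one a b → (one :+ :- :0) :* b :+ :- (:0 :+ :- :0) :* a := one :* b)
              refl 1# a b) (*-identityˡ b))

  conj[1-1]-*ᶜ : ∀ w → conj (1ᶜ -ᶜ 1ᶜ) *ᶜ w ≡ 0ᶜ
  conj[1-1]-*ᶜ (a , b) = cong₂ _,_
    (solve 3 (λ one a b → (one :+ :- one) :* a :+ :- (:- (:0 :+ :- :0) :* b) := :0) refl 1# a b)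
    (solve 3 (λ one a b → (one :+ :- one) :* b :+ :- (:0 :+ :- :0) :* a := :0) refl 1# a b)

  -- re and im are additive real coordinates on ℂ commuting with real
  -- scalars; sign information is transported through sums along them.
  record Coordinate (p : ℂ → Carrier) : Set where
    field
      additive : ∀ u w → p (u +ᶜ w) ≡ p u + p w
      at-0 : p 0ᶜ ≡ 0#
      scaling : ∀ r w → p (ofReal r *ᶜ w) ≡ r * p w

  re-coordinate : Coordinate re
  re-coordinate = record { additive = λ _ _ → refl ; at-0 = refl ; scaling = re-ofReal-*ᶜ }

  im-coordinate : Coordinate im
  im-coordinate = record { additive = λ _ _ → refl ; at-0 = refl ; scaling = im-ofReal-*ᶜ }

module ComplexSums (F : RealField) where
  open RealField F
  open Complex F
  open OrderedField F
  open ComplexFacts F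
  open import Data.Fin.Properties using (suc-injective)

  sumᶜ-cong : ∀ {n} {f g : Fin n → ℂ} → (∀ i → f i ≡ g i) → sumᶜ f ≡ sumᶜ g
  sumᶜ-cong {zero} f≗g = refl
  sumᶜ-cong {suc n} f≗g = cong₂ _+ᶜ_ (f≗g zero) (sumᶜ-cong (λ i → f≗g (suc i)))

  sumᶜ-zero : ∀ {n} (f : Fin n → ℂ) → (∀ i → f i ≡ 0ᶜ) → sumᶜ f ≡ 0ᶜ
  sumᶜ-zero {zero} f f≗0 = refl
  sumᶜ-zero {suc n} f f≗0 =
    trans (cong₂ _+ᶜ_ (f≗0 zero) (sumᶜ-zero (λ i → f (suc i)) (λ i → f≗0 (suc i))))
          (+ᶜ-identityˡ 0ᶜ)

  sumᶜ-+ : ∀ {n} (f g : Fin n → ℂ) → sumᶜ (λ i → f i +ᶜ g i) ≡ sumᶜ f +ᶜ sumᶜ g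
  sumᶜ-+ {zero} f g = sym (+ᶜ-identityˡ 0ᶜ)
  sumᶜ-+ {suc n} f g =
    trans (cong (f zero +ᶜ g zero +ᶜ_) (sumᶜ-+ (λ i → f (suc i)) (λ i → g (suc i))))
          (+ᶜ-interchange _ _ _ _)

  sumᶜ-scaleˡ : ∀ {n} c (f : Fin n → ℂ) → c *ᶜ sumᶜ f ≡ sumᶜ (λ i → c *ᶜ f i)
  sumᶜ-scaleˡ {zero} c f = *ᶜ-zeroʳ c
  sumᶜ-scaleˡ {suc n} c f =
    trans (*ᶜ-distribˡ c _ _) (cong (c *ᶜ f zero +ᶜ_) (sumᶜ-scaleˡ c (λ i → f (suc i))))

  sumᶜ-swap : ∀ {m n} (f : Fin m → Fin n → ℂ) →
    sumᶜ (λ x → sumᶜ (λ y → f x y)) ≡ sumᶜ (λ y → sumᶜ (λ x → f x y))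
  sumᶜ-swap {zero} f = sym (sumᶜ-zero _ (λ _ → refl))
  sumᶜ-swap {suc m} f =
    trans (cong (sumᶜ (f zero) +ᶜ_) (sumᶜ-swap (λ x → f (suc x))))
          (sym (sumᶜ-+ (f zero) (λ y → sumᶜ (λ x → f (suc x) y))))

  sumᶜ-single : ∀ {n} (f : Fin n → ℂ) (a : Fin n) → (∀ i → i ≢ a → f i ≡ 0ᶜ) → sumᶜ f ≡ f a
  sumᶜ-single f zero f≗0 =
    trans (cong (f zero +ᶜ_) (sumᶜ-zero _ (λ i → f≗0 (suc i) (λ ()))))
          (+ᶜ-identityʳ (f zero))
  sumᶜ-single f (suc a) f≗0 =
    trans (cong₂ _+ᶜ_ (f≗0 zero (λ ()))
                      (sumᶜ-single (λ i → f (suc i)) a (λ i i≢a → f≗0 (suc i) (i≢a ∘ suc-injective))))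
          (+ᶜ-identityˡ (f (suc a)))
    where open import Function using (_∘_)

  sumᶜ-in-cone : ∀ {p P} → Coordinate p → Cone P →
    ∀ {n} (f : Fin n → ℂ) → (∀ i → P (p (f i))) → P (p (sumᶜ f))
  sumᶜ-in-cone {P = P} cp cone {zero} f f∈P = subst P (sym (Coordinate.at-0 cp)) (Cone.has-0 cone)
  sumᶜ-in-cone {P = P} cp cone {suc n} f f∈P =
    subst P (sym (Coordinate.additive cp _ _))
      (Cone.+-closed cone (f∈P zero) (sumᶜ-in-cone cp cone (λ i → f (suc i)) (λ i → f∈P (suc i))))

module ElectricalNetworks (F : RealField) where
  open RealField F
  open Complex F
  open Network F
  open OrderedField F
  open ComplexFacts F
  open ComplexSums F
  open ≡-Reasoning

  Symmetric : ∀ {n} → (Fin n → Fin n → ℂ) → Set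
  Symmetric ρ = ∀ x y → ρ x y ≡ ρ y x

  laplacian : ∀ {n} → (Fin n → Fin n → ℂ) → (Fin n → ℂ) → Fin n → ℂ
  laplacian ρ v x = sumᶜ (λ y → (v y -ᶜ v x) *ᶜ ρ x y)

  -- Σ_{x,y} |v y - v x|² ρ_xy: twice the complex power of the potential v.
  dissipation : ∀ {n} → (Fin n → Fin n → ℂ) → (Fin n → ℂ) → ℂ
  dissipation ρ v = sumᶜ (λ x → sumᶜ (λ y → ofReal (normSq (v y -ᶜ v x)) *ᶜ ρ x y))

  green : ∀ {n} {ρ : Fin n → Fin n → ℂ} → Symmetric ρ → (u v : Fin n → ℂ) →
    let S = sumᶜ (λ x → conj (u x) *ᶜ laplacian ρ v x) in
    S +ᶜ S ≡ sumᶜ (λ x → sumᶜ (λ y → conj (u x -ᶜ u y) *ᶜ ((v y -ᶜ v x) *ᶜ ρ x y)))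
  green {ρ = ρ} ρ-sym u v = begin
    S +ᶜ S                                                   ≡⟨ cong₂ _+ᶜ_ S≡ΣG (trans S≡ΣG (sumᶜ-swap G)) ⟩
    sumᶜ (λ x → sumᶜ (G x)) +ᶜ sumᶜ (λ x → sumᶜ (λ y → G y x))  ≡⟨ sumᶜ-+ _ _ ⟨
    sumᶜ (λ x → sumᶜ (G x) +ᶜ sumᶜ (λ y → G y x))             ≡⟨ sumᶜ-cong (λ x → sumᶜ-+ _ _) ⟨
    sumᶜ (λ x → sumᶜ (λ y → G x y +ᶜ G y x))                  ≡⟨ sumᶜ-cong (λ x → sumᶜ-cong (paired x)) ⟩
    sumᶜ (λ x → sumᶜ (λ y → conj (u x -ᶜ u y) *ᶜ ((v y -ᶜ v x) *ᶜ ρ x y))) ∎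
    where
    S = sumᶜ (λ x → conj (u x) *ᶜ laplacian ρ v x)
    G : Fin _ → Fin _ → ℂ
    G x y = conj (u x) *ᶜ ((v y -ᶜ v x) *ᶜ ρ x y)
    S≡ΣG : S ≡ sumᶜ (λ x → sumᶜ (G x))
    S≡ΣG = sumᶜ-cong (λ x → sumᶜ-scaleˡ (conj (u x)) _)
    paired : ∀ x y → G x y +ᶜ G y x ≡ conj (u x -ᶜ u y) *ᶜ ((v y -ᶜ v x) *ᶜ ρ x y)
    paired x y = trans (cong (λ r → G x y +ᶜ conj (u y) *ᶜ ((v x -ᶜ v y) *ᶜ r)) (sym (ρ-sym x y)))
                       (edge-pair (u x) (u y) (v x) (v y) (ρ x y))

  -- Apply Green's identity with the
  -- test function u = 1 - v, whose pairing with Δv only sees the terminal a₀.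
  energy-identity : ∀ {n} {ρ : Fin n → Fin n → ℂ} {a₀ a₁ : Fin n} {v} → Symmetric ρ →
    Dirichlet ρ a₀ a₁ v → laplacian ρ v a₀ +ᶜ laplacian ρ v a₀ ≡ dissipation ρ v
  energy-identity {ρ = ρ} {a₀} {a₁} {v} ρ-sym (harmonic , v₀ , v₁) = begin
    Δ a₀ +ᶜ Δ a₀    ≡⟨ cong₂ _+ᶜ_ S≡Δa₀ S≡Δa₀ ⟨
    S +ᶜ S          ≡⟨ green ρ-sym u v ⟩
    sumᶜ (λ x → sumᶜ (λ y → conj (u x -ᶜ u y) *ᶜ ((v y -ᶜ v x) *ᶜ ρ x y)))
                    ≡⟨ sumᶜ-cong (λ x → sumᶜ-cong (λ y → edge-energy (v x) (v y) (ρ x y))) ⟩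
    dissipation ρ v ∎
    where
    Δ = laplacian ρ v
    u : Fin _ → ℂ
    u x = 1ᶜ -ᶜ v x
    S = sumᶜ (λ x → conj (u x) *ᶜ Δ x)
    vanishes : ∀ x → x ≢ a₀ → conj (u x) *ᶜ Δ x ≡ 0ᶜ
    vanishes x x≢a₀ with x ≟ a₁
    ... | yes refl = trans (cong (λ w → conj (1ᶜ -ᶜ w) *ᶜ Δ x) v₁) (conj[1-1]-*ᶜ (Δ x))
    ... | no x≢a₁ = trans (cong (conj (u x) *ᶜ_) (harmonic x x≢a₀ x≢a₁)) (*ᶜ-zeroʳ _)
    S≡Δa₀ : S ≡ Δ a₀
    S≡Δa₀ = trans (sumᶜ-single _ a₀ vanishes)
                  (trans (cong (λ w → conj (1ᶜ -ᶜ w) *ᶜ Δ a₀) v₀) (conj[1-0]-*ᶜ (Δ a₀)))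

  current≡laplacian : ∀ {n} {adj : Fin n → Fin n → Bool} {ρ a₀ v} → Symmetric ρ →
    (∀ x y → adj x y ≡ false → ρ x y ≡ 0ᶜ) → v a₀ ≡ 0ᶜ →
    current adj ρ a₀ v ≡ laplacian ρ v a₀
  current≡laplacian {adj = adj} {ρ} {a₀} {v} ρ-sym ρ-off v₀ = sumᶜ-cong term
    where
    term : ∀ x → (if adj x a₀ then v x *ᶜ ρ x a₀ else 0ᶜ) ≡ (v x -ᶜ v a₀) *ᶜ ρ a₀ x
    term x with adj x a₀ in e
    ... | true = cong₂ _*ᶜ_ (sym (trans (cong (_-ᶜ_ (v x)) v₀) (-ᶜ-zeroʳ (v x)))) (ρ-sym x a₀)
    ... | false = sym (trans (cong (_ *ᶜ_) (trans (ρ-sym a₀ x) (ρ-off x a₀ e))) (*ᶜ-zeroʳ _))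

  dissipation-in-cone : ∀ {n} {ρ : Fin n → Fin n → ℂ} {p P} → Coordinate p → Cone P →
    (∀ x y → P (p (ρ x y))) → ∀ v → P (p (dissipation ρ v))
  dissipation-in-cone {P = P} cp cone ρ∈P v =
    sumᶜ-in-cone cp cone _ (λ x → sumᶜ-in-cone cp cone _ (λ y →
      subst P (sym (Coordinate.scaling cp _ _))
        (Cone.scale-closed cone (normSq-nonneg (v y -ᶜ v x)) (ρ∈P x y))))

  current-in-cone : ∀ {n} {adj : Fin n → Fin n → Bool} {ρ a₀ a₁ v} {p P} →
    Symmetric ρ → (∀ x y → adj x y ≡ false → ρ x y ≡ 0ᶜ) → Dirichlet ρ a₀ a₁ v →
    Coordinate p → Cone P → (∀ x y → P (p (ρ x y))) → P (p (current adj ρ a₀ v))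
  current-in-cone {adj = adj} {ρ} {a₀} {v = v} {p} {P} ρ-sym ρ-off dir cp cone ρ∈P =
    Cone.halve cone (subst P twice (dissipation-in-cone cp cone ρ∈P v))
    where
    I = current adj ρ a₀ v
    twice : p (dissipation ρ v) ≡ p I + p I
    twice = begin
      p (dissipation ρ v)                              ≡⟨ cong p (energy-identity ρ-sym dir) ⟨
      p (laplacian ρ v a₀ +ᶜ laplacian ρ v a₀)         ≡⟨ cong (λ w → p (w +ᶜ w)) I≡Δ ⟨
      p (I +ᶜ I)                                       ≡⟨ Coordinate.additive cp I I ⟩
      p I + p I                                        ∎
      where I≡Δ = current≡laplacian ρ-sym ρ-off (proj₁ (proj₂ dir))

  admittance-symmetric : ∀ {n} {adj : Fin n → Fin n → Bool} {z} →
    (∀ x y → adj x y ≡ adj y x) → (∀ x y → Edge adj x y → z x y ≡ z y x) →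
    Symmetric (admittance adj z)
  admittance-symmetric {adj = adj} adj-sym z-sym x y rewrite adj-sym x y with adj y x in e
  ... | true = cong invᶜ (z-sym x y (trans (adj-sym x y) e))
  ... | false = refl

  admittance-off-edge : ∀ {n} {adj : Fin n → Fin n → Bool} {z} →
    ∀ x y → adj x y ≡ false → admittance adj z x y ≡ 0ᶜ
  admittance-off-edge {z = z} x y e = cong (if_then invᶜ (z x y) else 0ᶜ) e

  admittance-in-cone : ∀ {n} {adj : Fin n → Fin n → Bool} {z} {p P} → Coordinate p → Cone P →
    (∀ x y → Edge adj x y → P (p (invᶜ (z x y)))) → ∀ x y → P (p (admittance adj z x y))
  admittance-in-cone {adj = adj} {P = P} cp cone edge∈P x y with adj x y in e
  ... | true = edge∈P x y e
  ... | false = subst P (sym (Coordinate.at-0 cp)) (Cone.has-0 cone)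

open Network using (noSolution; finite)

theorem2p10 : (F : RealField) →
    let open RealField F
        open Complex F
        open Network F
    in (n : ℕ) (adj : Fin n → Fin n → Bool) →
       (∀ x y → adj x y ≡ adj y x) → (∀ x → adj x x ≡ false) → Connected adj →
       (a₀ a₁ : Fin n) → a₀ ≢ a₁ →
       (ω : Carrier) → 0# < ω →
       (R L D : Fin n → Fin n → Carrier) →
       (∀ x y → Edge adj x y → (R x y ≡ R y x) × (L x y ≡ L y x) × (D x y ≡ D y x)) →
       (∀ x y → Edge adj x y → (0# ≤ R x y) × (0# ≤ L x y) × (0# ≤ D x y)) →
       (∀ x y → Edge adj x y → R x y * R x y + L x y * L x y + D x y * D x y ≢ 0#) →
       let z = λ x y → impedance ω (R x y) (L x y) (D x y)
           ρ = admittance adj z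
       in (∀ x y → Edge adj x y → z x y ≢ 0ᶜ) →
          (Z : ℂ) → EffImp adj ρ a₀ a₁ (just Z) →
          (0# ≤ re Z)
          × ((∀ x y → Edge adj x y → im (z x y) ≤ 0#) → im Z ≤ 0#)
          × ((∀ x y → Edge adj x y → 0# ≤ im (z x y)) → 0# ≤ im Z)
theorem2p10 F _ _ _ _ _ _ _ _ _ _ _ _ _ _ _ _ _ _ (noSolution _) =
  ≤-refl 0# , (λ _ → ≤-refl 0#) , (λ _ → ≤-refl 0#)
  where open RealField F
theorem2p10 F n adj adj-sym _ _ a₀ a₁ _ ω _ R L D RLD-sym RLD-nonneg _ z≢0 _ (finite v dir I≢0) =
    re-invᶜ-nonneg I I≢0 (current-sign re-coordinate nonneg-cone (λ x y e →
      re-invᶜ-nonneg (z x y) (z≢0 x y e)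
        (subst (0# ≤_) (sym (re-impedance ω _ _ _)) (proj₁ (RLD-nonneg x y e)))))
  , (λ im-z≤0 → im-invᶜ-nonpos I I≢0 (current-sign im-coordinate nonneg-cone (λ x y e →
      im-invᶜ-nonneg (z x y) (z≢0 x y e) (im-z≤0 x y e))))
  , (λ 0≤im-z → im-invᶜ-nonneg I I≢0 (current-sign im-coordinate nonpos-cone (λ x y e →
      im-invᶜ-nonpos (z x y) (z≢0 x y e) (0≤im-z x y e))))
  where
  open RealField F
  open Complex F
  open Network F
  open OrderedField F
  open ComplexFacts F
  open ElectricalNetworks F
  z : Fin n → Fin n → ℂ
  z x y = impedance ω (R x y) (L x y) (D x y)
  I : ℂ
  I = current adj (admittance adj z) a₀ v
  z-sym : ∀ x y → Edge adj x y → z x y ≡ z y x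
  z-sym x y e with RLD-sym x y e
  ... | R-sym , L-sym , D-sym rewrite R-sym | L-sym | D-sym = refl
  current-sign : ∀ {p P} → Coordinate p → Cone P →
    (∀ x y → Edge adj x y → P (p (invᶜ (z x y)))) → P (p I)
  current-sign cp cone edge∈P =
    current-in-cone (admittance-symmetric adj-sym z-sym) admittance-off-edge dir cp cone
      (admittance-in-cone cp cone edge∈P)
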